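{- Let $q\ge 5$. Then in the closure order $\preceq$ on $\mathbf W(q-2,2)$ the following relations hold: (1) $\gamma_{j+1,\,q+1-j}\preceq\gamma_{j,\,q+3-j}$ for every integer $j$ with $3\le j<q/2$; (2) $\gamma_{q-j,\,j+1}\preceq\gamma_{q-j+2,\,j}$ for every integer $j$ with $q/2+1<j\le q-1$.
   Context: Permutations in $\mathfrak S_q$ are composed right to left; $(i,\dots,u)$ is the cycle $i\mapsto i+1\mapsto\cdots\mapsto u\mapsto i$. $\mathfrak S_q$ is a Coxeter group with simple reflections $s_i=(i,i+1)$, length $\ell$ = number of inversions, and Bruhat order $\le$ (the standard Bruhat order: $w'\le w$ iff there is a chain $w'=v_0,\dots,v_m=w$ with $\ell(v_{i-1})\le\ell(v_i)$ and each $v_{i-1}^{ -1}v_i$ a reflection). For $1\le u<v\le q$ let $\gamma_{u,v}=(2,3,\ldots,v)(1,2,\ldots,u)$; the set $\mathbf W(q-2,2)=\{\gamma_{u,v}:1\le u<v\le q\}$ is the set of minimal-length representatives of $W_J\backslash\mathfrak S_q$, where $J=\{s_1,\dots,s_{q-1}\}\setminus\{s_2\}$ and $W_J=\langle J\rangle$. Let $w_{0,J}$ be the longest element of $W_J$, i.e. the permutation swapping $1$ and $2$ and sending $x\mapsto q+3-x$ for $3\le x\le q$. The closure order on $\mathbf W(q-2,2)$ is defined by: $w\preceq w'$ iff there exists $h\in W_J$ with $$h\,w\,w_{0,J}\,h^{ -1}\,w_{0,J}\le w'$$ in the Bruhat order of $\mathfrak S_q$. (This order describes topological closure relations between Ekedahl–Oort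 strata of the unitary Shimura variety of signature $(q-2,2)$.) -}

module Defs where

open import Data.Nat using (ℕ; zero; suc; _+_; _*_; _∸_; _≤_; _<_; _≡ᵇ_; _<ᵇ_; _≤ᵇ_)
open import Data.Bool using (Bool; true; false; if_then_else_; _∧_)
open import Data.List using (List; []; _∷_; map; upTo)
open import Data.Nat.ListAction using (sum)
open import Data.List.Relation.Unary.All using (All)
open import Data.Product using (Σ; _×_)
open import Relation.Binary.PropositionalEquality using (_≡_; _≢_)
open import Function using (_∘_; id)

-- Permutations of {1,…,q} are represented (1-indexed, as in the paper) by
-- functions ℕ → ℕ; all permutations we build fix every point outside {1,…,q}.
-- Composition is ordinary function composition (right to left).
Perm : Set
Perm = ℕ → ℕ

_≈[_]_ : Perm → ℕ → Perm → Set
f ≈[ q ] g = ∀ x → 1 ≤ x → x ≤ q → f x ≡ g x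

-- the cycle (i, i+1, …, u) : i ↦ i+1 ↦ ⋯ ↦ u ↦ i
cyc : ℕ → ℕ → Perm
cyc i u x = if (i ≤ᵇ x) ∧ (x <ᵇ u) then suc x else (if x ≡ᵇ u then i else x)

γ : ℕ → ℕ → Perm
γ u v = cyc 2 v ∘ cyc 1 u

transp : ℕ → ℕ → Perm
transp a b x = if x ≡ᵇ a then b else (if x ≡ᵇ b then a else x)

s : ℕ → Perm
s i = transp i (suc i)

-- length ℓ = number of inversions: pairs 1 ≤ i < j ≤ q with w(i) > w(j)
len : ℕ → Perm → ℕ
len q w = sum (map (λ j' → sum (map (λ i' → if w (suc j') <ᵇ w (suc i') then 1 else 0) (upTo j'))) (upTo q))

-- Bruhat order on 𝔖_q: w' ≤ w iff there is a chain w' = v₀, …, v_m = w with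
-- ℓ(v_{k-1}) ≤ ℓ(v_k) and v_{k-1}⁻¹ v_k a reflection, i.e. a transposition (a b),
-- 1 ≤ a < b ≤ q; equivalently v_k = v_{k-1} ∘ (a b).
data BruhatLe (q : ℕ) : Perm → Perm → Set where
  done : ∀ {v w} → v ≈[ q ] w → BruhatLe q v w
  step : ∀ {v w} (a b : ℕ) → 1 ≤ a → a < b → b ≤ q →
         len q v ≤ len q (v ∘ transp a b) →
         BruhatLe q (v ∘ transp a b) w → BruhatLe q v w

-- J = {s_1,…,s_{q-1}} ∖ {s_2}; elements of W_J = ⟨J⟩ are products of words in J
InJ : ℕ → ℕ → Set
InJ q i = (1 ≤ i) × (i < q) × (i ≢ 2)

evalW : List ℕ → Perm
evalW [] = id
evalW (i ∷ is) = s i ∘ evalW is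

evalWinv : List ℕ → Perm
evalWinv [] = id
evalWinv (i ∷ is) = evalWinv is ∘ s i

w0J : ℕ → Perm
w0J q x = if x ≡ᵇ 1 then 2 else (if x ≡ᵇ 2 then 1 else
            (if (3 ≤ᵇ x) ∧ (x ≤ᵇ q) then (q + 3) ∸ x else x))

-- closure order: w ⪯ w' iff ∃ h ∈ W_J with h w w_{0,J} h⁻¹ w_{0,J} ≤ w'
ClosureLe : ℕ → Perm → Perm → Set
ClosureLe q w w' = Σ (List ℕ) λ word → All (InJ q) word ×
  BruhatLe q (evalW word ∘ w ∘ w0J q ∘ evalWinv word ∘ w0J q) w'

{-# OPTIONS --safe #-}
module Submission where

-- Both relations are witnessed by a single simple reflection h = s_k ∈ W_J: k = m + 1 for
-- γ_{j+1,m} ⪯ γ_{j,m+2} and k = n + 2 for γ_{n,j+1} ⪯ γ_{n+2,j}. As w_{0,J} reverses 3, …, q, it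
-- conjugates s_k to s_j with k + j = q + 2, so h w w_{0,J} h⁻¹ w_{0,J} = s_k w s_j. Computing with
-- the cycles, s_k w s_j (a, a+2) = w′ with w′(a+2) < w′(a), for a = m resp. a = n; hence
-- s_k w s_j ≤ w′ is one Bruhat step, because right multiplication by a transposition (a b) with
-- v a < v b does not decrease the number of inversions.

open import Defs
open import Data.Bool using (Bool; true; false; if_then_else_)
open import Data.Bool.Properties using (∧-zeroʳ)
open import Data.List using ([]; _∷_; map; upTo; _++_)
open import Data.List.Properties using (upTo-∷ʳ; map-++)
open import Data.List.Relation.Unary.All using ([]; _∷_)
open import Data.Nat
  using (ℕ; zero; suc; _+_; _*_; _∸_; _≤_; _<_; _≤′_; ≤′-refl; ≤′-step; z≤n; s≤s; _≡ᵇ_; _<ᵇ_; _≤ᵇ_)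
open import Data.Nat.ListAction using (sum)
open import Data.Nat.ListAction.Properties using (sum-++)
open import Data.Nat.Properties
open import Data.Nat.Tactic.RingSolver using (solve-∀)
open import Data.Product using (_×_; _,_)
open import Data.Sum using (_⊎_; inj₁; inj₂)
open import Function using (_∘_)
open import Relation.Binary.PropositionalEquality
open import Relation.Binary.Definitions using (tri<; tri≈; tri>)
open import Relation.Nullary using (yes; no; contradiction)

≡ᵇ-refl : ∀ n → (n ≡ᵇ n) ≡ true
≡ᵇ-refl zero    = refl
≡ᵇ-refl (suc n) = ≡ᵇ-refl n

≢⇒≡ᵇ-false : ∀ {m n} → m ≢ n → (m ≡ᵇ n) ≡ false
≢⇒≡ᵇ-false {zero}  {zero}  m≢n = contradiction refl m≢n
≢⇒≡ᵇ-false {zero}  {suc n} _   = refl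
≢⇒≡ᵇ-false {suc m} {zero}  _   = refl
≢⇒≡ᵇ-false {suc m} {suc n} m≢n = ≢⇒≡ᵇ-false (m≢n ∘ cong suc)

<⇒<ᵇ-true : ∀ {m n} → m < n → (m <ᵇ n) ≡ true
<⇒<ᵇ-true {zero}  {suc n} _         = refl
<⇒<ᵇ-true {suc m} {suc n} (s≤s m<n) = <⇒<ᵇ-true m<n

≥⇒<ᵇ-false : ∀ {m n} → n ≤ m → (m <ᵇ n) ≡ false
≥⇒<ᵇ-false {m}     {zero}  _         = refl
≥⇒<ᵇ-false {suc m} {suc n} (s≤s n≤m) = ≥⇒<ᵇ-false n≤m

≤⇒≤ᵇ-true : ∀ {m n} → m ≤ n → (m ≤ᵇ n) ≡ true
≤⇒≤ᵇ-true {zero}  _   = refl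
≤⇒≤ᵇ-true {suc m} m<n = <⇒<ᵇ-true m<n

>⇒≤ᵇ-false : ∀ {m n} → n < m → (m ≤ᵇ n) ≡ false
>⇒≤ᵇ-false {suc m} (s≤s n≤m) = ≥⇒<ᵇ-false n≤m

transp-a : ∀ a b → transp a b a ≡ b
transp-a a b rewrite ≡ᵇ-refl a = refl

transp-b : ∀ {a b} → a ≢ b → transp a b b ≡ a
transp-b {a} {b} a≢b rewrite ≢⇒≡ᵇ-false (a≢b ∘ sym) | ≡ᵇ-refl b = refl

transp-other : ∀ {a b y} → y ≢ a → y ≢ b → transp a b y ≡ y
transp-other y≢a y≢b rewrite ≢⇒≡ᵇ-false y≢a | ≢⇒≡ᵇ-false y≢b = refl

transp-comm : ∀ {a b} → a ≢ b → ∀ y → transp a b y ≡ transp b a y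
transp-comm {a} {b} a≢b y with y ≟ a | y ≟ b
... | yes refl | _        = trans (transp-a y b) (sym (transp-b (a≢b ∘ sym)))
... | no _     | yes refl = trans (transp-b a≢b) (sym (transp-a y a))
... | no y≢a   | no y≢b   = trans (transp-other y≢a y≢b) (sym (transp-other y≢b y≢a))

transp-involutive : ∀ {a b} → a ≢ b → ∀ y → transp a b (transp a b y) ≡ y
transp-involutive {a} {b} a≢b y with y ≟ a | y ≟ b
... | yes refl | _        = trans (cong (transp y b) (transp-a y b)) (transp-b a≢b)
... | no _     | yes refl = trans (cong (transp a y) (transp-b a≢b)) (transp-a a y)
... | no y≢a   | no y≢b   = trans (cong (transp a b) (transp-other y≢a y≢b)) (transp-other y≢a y≢b)

conj-transp : ∀ (f : Perm) → (∀ y → f (f y) ≡ y) → ∀ a b y → f (transp a b (f y)) ≡ transp (f a) (f b) y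
conj-transp f inv a b y with y ≟ f a | y ≟ f b
... | yes refl | _ = begin
  f (transp a b (f (f a)))  ≡⟨ cong (f ∘ transp a b) (inv a) ⟩
  f (transp a b a)          ≡⟨ cong f (transp-a a b) ⟩
  f b                       ≡⟨ transp-a (f a) (f b) ⟨
  transp (f a) (f b) (f a)  ∎
  where open ≡-Reasoning
... | no y≢fa | yes refl = begin
  f (transp a b (f (f b)))  ≡⟨ cong (f ∘ transp a b) (inv b) ⟩
  f (transp a b b)          ≡⟨ cong f (transp-b {a} {b} λ { refl → y≢fa refl }) ⟩
  f a                       ≡⟨ transp-b (y≢fa ∘ sym) ⟨
  transp (f a) (f b) (f b)  ∎
  where open ≡-Reasoning
... | no y≢fa | no y≢fb = begin
  f (transp a b (f y))  ≡⟨ cong f (transp-other (λ { refl → y≢fa (sym (inv y)) }) (λ { refl → y≢fb (sym (inv y)) })) ⟩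
  f (f y)               ≡⟨ inv y ⟩
  y                     ≡⟨ transp-other y≢fa y≢fb ⟨
  transp (f a) (f b) y  ∎
  where open ≡-Reasoning

s-a : ∀ a → s a a ≡ suc a
s-a a = transp-a a (suc a)

s-b : ∀ a → s a (suc a) ≡ a
s-b a = transp-b (<⇒≢ (n<1+n a))

s-below : ∀ {a y} → y < a → s a y ≡ y
s-below y<a = transp-other (<⇒≢ y<a) (<⇒≢ (m<n⇒m<1+n y<a))

s-above : ∀ {a y} → suc a < y → s a y ≡ y
s-above 1+a<y = transp-other (>⇒≢ (<-trans (n<1+n _) 1+a<y)) (>⇒≢ 1+a<y)

s-involutive : ∀ a y → s a (s a y) ≡ y
s-involutive a = transp-involutive (<⇒≢ (n<1+n a))

iverson : Bool → ℕ
iverson b = if b then 1 else 0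

Σ< : ℕ → (ℕ → ℕ) → ℕ
Σ< n f = sum (map f (upTo n))

Σ<-suc : ∀ n f → Σ< (suc n) f ≡ Σ< n f + f n
Σ<-suc n f = begin
  sum (map f (upTo (suc n)))        ≡⟨ cong (sum ∘ map f) (upTo-∷ʳ n) ⟨
  sum (map f (upTo n ++ n ∷ []))    ≡⟨ cong sum (map-++ f (upTo n) (n ∷ [])) ⟩
  sum (map f (upTo n) ++ f n ∷ [])  ≡⟨ sum-++ (map f (upTo n)) (f n ∷ []) ⟩
  Σ< n f + (f n + 0)                ≡⟨ cong (Σ< n f +_) (+-identityʳ (f n)) ⟩
  Σ< n f + f n                      ∎
  where open ≡-Reasoning

Σ<-cong : ∀ n {f g} → (∀ i → i < n → f i ≡ g i) → Σ< n f ≡ Σ< n g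
Σ<-cong zero    f≗g = refl
Σ<-cong (suc n) {f} {g} f≗g = begin
  Σ< (suc n) f  ≡⟨ Σ<-suc n f ⟩
  Σ< n f + f n  ≡⟨ cong₂ _+_ (Σ<-cong n (λ i i<n → f≗g i (m<n⇒m<1+n i<n))) (f≗g n ≤-refl) ⟩
  Σ< n g + g n  ≡⟨ Σ<-suc n g ⟨
  Σ< (suc n) g  ∎
  where open ≡-Reasoning

above : ℕ → Perm → ℕ → ℕ
above c w n = Σ< n (λ i → iverson (c <ᵇ w (suc i)))

above-suc : ∀ c w n → above c w (suc n) ≡ above c w n + iverson (c <ᵇ w (suc n))
above-suc c w n = Σ<-suc n (λ i → iverson (c <ᵇ w (suc i)))

len-suc : ∀ n w → len (suc n) w ≡ len n w + above (w (suc n)) w n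
len-suc n w = Σ<-suc n (λ r → above (w (suc r)) w r)

≈-restrict : ∀ {m n f g} → m ≤ n → f ≈[ n ] g → f ≈[ m ] g
≈-restrict m≤n f≈g x 1≤x x≤m = f≈g x 1≤x (≤-trans x≤m m≤n)

above-cong : ∀ c n {f g} → f ≈[ n ] g → above c f n ≡ above c g n
above-cong c n f≈g = Σ<-cong n λ i i<n → cong (iverson ∘ (c <ᵇ_)) (f≈g (suc i) (s≤s z≤n) i<n)

len-cong : ∀ n {f g} → f ≈[ n ] g → len n f ≡ len n g
len-cong n {f} {g} f≈g = Σ<-cong n λ r r<n →
  trans (cong (λ c → above c f r) (f≈g (suc r) (s≤s z≤n) r<n))
        (above-cong _ r (≈-restrict (<⇒≤ r<n) f≈g))

∘s-≈-below : ∀ v m → (v ∘ s (suc m)) ≈[ m ] v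
∘s-≈-below v m x _ x≤m = cong v (s-below (s≤s x≤m))

above-∘s : ∀ c v m {n} → suc (suc m) ≤′ n → above c (v ∘ s (suc m)) n ≡ above c v n
above-∘s c v m ≤′-refl = begin
  above c v′ (2 + m)                                                  ≡⟨ expand v′ ⟩
  above c v′ m + iverson (c <ᵇ v′ (suc m)) + iverson (c <ᵇ v′ (2 + m))
    ≡⟨ cong₂ (λ A y → A + iverson (c <ᵇ v y) + iverson (c <ᵇ v′ (2 + m)))
             (above-cong c m (∘s-≈-below v m)) (s-a (suc m)) ⟩
  above c v m + iverson (c <ᵇ v (2 + m)) + iverson (c <ᵇ v′ (2 + m))
    ≡⟨ cong (λ y → above c v m + iverson (c <ᵇ v (2 + m)) + iverson (c <ᵇ v y)) (s-b (suc m)) ⟩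
  above c v m + iverson (c <ᵇ v (2 + m)) + iverson (c <ᵇ v (suc m))   ≡⟨ swap (above c v m) _ _ ⟩
  above c v m + iverson (c <ᵇ v (suc m)) + iverson (c <ᵇ v (2 + m))   ≡⟨ expand v ⟨
  above c v (2 + m)                                                   ∎
  where
  open ≡-Reasoning
  v′ = v ∘ s (suc m)
  expand : ∀ w → above c w (2 + m) ≡ above c w m + iverson (c <ᵇ w (suc m)) + iverson (c <ᵇ w (2 + m))
  expand w = trans (above-suc c w (suc m)) (cong (_+ iverson (c <ᵇ w (2 + m))) (above-suc c w m))
  swap : ∀ a x y → a + x + y ≡ a + y + x
  swap = solve-∀
above-∘s c v m {suc n} (≤′-step 2+m≤′n) = begin
  above c v′ (suc n)                         ≡⟨ above-suc c v′ n ⟩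
  above c v′ n + iverson (c <ᵇ v′ (suc n))   ≡⟨ cong₂ (λ a b → a + iverson (c <ᵇ v b)) (above-∘s c v m 2+m≤′n)
                                                       (s-above (s≤s (≤′⇒≤ 2+m≤′n))) ⟩
  above c v n + iverson (c <ᵇ v (suc n))     ≡⟨ above-suc c v n ⟨
  above c v (suc n)                          ∎
  where
  open ≡-Reasoning
  v′ = v ∘ s (suc m)

len-∘s : ∀ v m {n} → suc (suc m) ≤′ n →
  len n (v ∘ s (suc m)) + iverson (v (2 + m) <ᵇ v (suc m)) ≡ len n v + iverson (v (suc m) <ᵇ v (2 + m))
len-∘s v m ≤′-refl = begin
  len (2 + m) v′ + α         ≡⟨ cong (_+ α) expand′ ⟩
  len m v + x + (y + β) + α  ≡⟨ rearrange (len m v) x y α β ⟩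
  len m v + y + (x + α) + β  ≡⟨ cong (_+ β) (expand v) ⟨
  len (2 + m) v + β          ∎
  where
  open ≡-Reasoning
  v′ = v ∘ s (suc m)
  α = iverson (v (2 + m) <ᵇ v (suc m))
  β = iverson (v (suc m) <ᵇ v (2 + m))
  x = above (v (2 + m)) v m
  y = above (v (suc m)) v m
  rearrange : ∀ L x y α β → L + x + (y + β) + α ≡ L + y + (x + α) + β
  rearrange = solve-∀
  expand : ∀ w → len (2 + m) w ≡ len m w + above (w (suc m)) w m + (above (w (2 + m)) w m + iverson (w (2 + m) <ᵇ w (suc m)))
  expand w = trans (len-suc (suc m) w) (cong₂ _+_ (len-suc m w) (above-suc (w (2 + m)) w m))
  below = ∘s-≈-below v m
  expand′ : len (2 + m) v′ ≡ len m v + x + (y + β)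
  expand′ = begin
    len (2 + m) v′  ≡⟨ expand v′ ⟩
    len m v′ + above (v′ (suc m)) v′ m + (above (v′ (2 + m)) v′ m + iverson (v′ (2 + m) <ᵇ v′ (suc m)))
      ≡⟨ cong₂ (λ c d → len m v′ + above c v′ m + (above d v′ m + iverson (d <ᵇ c)))
               (cong v (s-a (suc m))) (cong v (s-b (suc m))) ⟩
    len m v′ + above (v (2 + m)) v′ m + (above (v (suc m)) v′ m + β)
      ≡⟨ cong₂ (λ L A → L + A + (above (v (suc m)) v′ m + β)) (len-cong m below) (above-cong _ m below) ⟩
    len m v + x + (above (v (suc m)) v′ m + β)
      ≡⟨ cong (λ B → len m v + x + (B + β)) (above-cong _ m below) ⟩
    len m v + x + (y + β)  ∎
len-∘s v m {suc n} (≤′-step 2+m≤′n) = begin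
  len (suc n) v′ + α                                 ≡⟨ cong (_+ α) (len-suc n v′) ⟩
  len n v′ + above (v′ (suc n)) v′ n + α             ≡⟨ cong (λ c → len n v′ + above c v′ n + α) v′[1+n]≡v[1+n] ⟩
  len n v′ + above (v (suc n)) v′ n + α              ≡⟨ cong (λ A → len n v′ + A + α) (above-∘s _ v m 2+m≤′n) ⟩
  len n v′ + above (v (suc n)) v n + α               ≡⟨ shift (len n v′) _ α ⟩
  len n v′ + α + above (v (suc n)) v n               ≡⟨ cong (_+ above (v (suc n)) v n) (len-∘s v m 2+m≤′n) ⟩
  len n v + β + above (v (suc n)) v n                ≡⟨ shift (len n v) _ β ⟨
  len n v + above (v (suc n)) v n + β                ≡⟨ cong (_+ β) (len-suc n v) ⟨
  len (suc n) v + β                                  ∎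
  where
  open ≡-Reasoning
  v′ = v ∘ s (suc m)
  α = iverson (v (2 + m) <ᵇ v (suc m))
  β = iverson (v (suc m) <ᵇ v (2 + m))
  v′[1+n]≡v[1+n] : v′ (suc n) ≡ v (suc n)
  v′[1+n]≡v[1+n] = cong v (s-above (s≤s (≤′⇒≤ 2+m≤′n)))
  shift : ∀ L A x → L + A + x ≡ L + x + A
  shift = solve-∀

≤-through-adjacent-swaps : ∀ {A B c L₀ L₁ L₂ L₃} → A < B →
  L₁ + iverson (B <ᵇ c) ≡ L₀ + iverson (c <ᵇ B) → L₁ ≤ L₂ →
  L₃ + iverson (c <ᵇ A) ≡ L₂ + iverson (A <ᵇ c) → L₀ ≤ L₃
≤-through-adjacent-swaps {A} {B} {c} {L₀} {L₁} {L₂} {L₃} A<B e₁ L₁≤L₂ e₃ with c <? A | B <? c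
... | yes c<A | yes B<c = contradiction (<-trans B<c c<A) (<⇒≯ A<B)
... | yes c<A | no B≮c
  rewrite <⇒<ᵇ-true c<A | ≥⇒<ᵇ-false (<⇒≤ c<A) | <⇒<ᵇ-true (<-trans c<A A<B) | ≥⇒<ᵇ-false (<⇒≤ (<-trans c<A A<B))
  = +-cancelʳ-≤ 1 L₀ L₃ (begin
    L₀ + 1  ≡⟨ e₁ ⟨
    L₁ + 0  ≡⟨ +-identityʳ L₁ ⟩
    L₁      ≤⟨ L₁≤L₂ ⟩
    L₂      ≡⟨ +-identityʳ L₂ ⟨
    L₂ + 0  ≡⟨ e₃ ⟨
    L₃ + 1  ∎)
  where open ≤-Reasoning
... | no c≮A | yes B<c
  rewrite <⇒<ᵇ-true B<c | ≥⇒<ᵇ-false (<⇒≤ B<c) | <⇒<ᵇ-true (<-trans A<B B<c) | ≥⇒<ᵇ-false (<⇒≤ (<-trans A<B B<c))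
  = begin
    L₀      ≡⟨ +-identityʳ L₀ ⟨
    L₀ + 0  ≡⟨ e₁ ⟨
    L₁ + 1  ≤⟨ +-monoˡ-≤ 1 L₁≤L₂ ⟩
    L₂ + 1  ≡⟨ e₃ ⟨
    L₃ + 0  ≡⟨ +-identityʳ L₃ ⟩
    L₃      ∎
  where open ≤-Reasoning
... | no c≮A | no B≮c
  rewrite ≥⇒<ᵇ-false (≮⇒≥ c≮A) | ≥⇒<ᵇ-false (≮⇒≥ B≮c)
  = begin
    L₀                          ≤⟨ m≤m+n L₀ _ ⟩
    L₀ + iverson (c <ᵇ B)       ≡⟨ e₁ ⟨
    L₁ + 0                      ≡⟨ +-identityʳ L₁ ⟩
    L₁                          ≤⟨ L₁≤L₂ ⟩
    L₂                          ≤⟨ m≤m+n L₂ _ ⟩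
    L₂ + iverson (A <ᵇ c)       ≡⟨ e₃ ⟨
    L₃ + 0                      ≡⟨ +-identityʳ L₃ ⟩
    L₃                          ∎
  where open ≤-Reasoning

-- Induction on b via (a b) = s_{b-1} (a, b-1) s_{b-1}. The outer swaps exchange c = v(b-1) first
-- with v b, then with v a; the first lowers the length only if c > v b, the second only if c < v a,
-- and then the other one raises it, since v a < v b.
len≤len-∘transp : ∀ q v {a b} → 1 ≤ a → a < b → b ≤ q → v a < v b → len q v ≤ len q (v ∘ transp a b)
len≤len-∘transp q v {a} {suc b} 1≤a a<1+b 1+b≤q va<vb with m≤n⇒m<n∨m≡n (≤-pred a<1+b)
len≤len-∘transp q v {suc m} {suc b} _ _ 1+b≤q va<vb | inj₂ refl = begin
  len q v                                        ≤⟨ m≤m+n (len q v) 1 ⟩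
  len q v + 1                                    ≡⟨ cong (λ x → len q v + iverson x) (<⇒<ᵇ-true va<vb) ⟨
  len q v + iverson (v (suc m) <ᵇ v (2 + m))     ≡⟨ len-∘s v m (≤⇒≤′ 1+b≤q) ⟨
  len q v′ + iverson (v (2 + m) <ᵇ v (suc m))    ≡⟨ cong (λ x → len q v′ + iverson x) (≥⇒<ᵇ-false (<⇒≤ va<vb)) ⟩
  len q v′ + 0                                   ≡⟨ +-identityʳ (len q v′) ⟩
  len q v′                                       ∎
  where
  open ≤-Reasoning
  v′ = v ∘ s (suc m)
len≤len-∘transp q v {a} {suc (suc m)} 1≤a _ 1+b≤q va<vb | inj₁ a<b =
  ≤-through-adjacent-swaps va<vb
    (len-∘s v m (≤⇒≤′ 1+b≤q))
    (len≤len-∘transp q v₁ 1≤a a<b (<⇒≤ 1+b≤q) (subst₂ _<_ (sym v₁a≡va) (sym (cong v (s-a b))) va<vb))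
    swap-back
  where
  b = suc m
  v₁ = v ∘ s b
  w = v₁ ∘ transp a b
  v₁a≡va : v₁ a ≡ v a
  v₁a≡va = cong v (s-below a<b)
  wb≡va : w b ≡ v a
  wb≡va = trans (cong v₁ (transp-b (<⇒≢ a<b))) v₁a≡va
  w[1+b]≡vb : w (suc b) ≡ v b
  w[1+b]≡vb = trans (cong v₁ (transp-other (>⇒≢ (<-trans a<b (n<1+n b))) (>⇒≢ (n<1+n b)))) (cong v (s-b b))
  w∘s≗v∘transp : ∀ y → w (s b y) ≡ v (transp a (suc b) y)
  w∘s≗v∘transp y = cong v (trans (conj-transp (s b) (s-involutive b) a b y)
                                 (cong₂ (λ x z → transp x z y) (s-below a<b) (s-a b)))
  swap-back : len q (v ∘ transp a (suc b)) + iverson (v b <ᵇ v a) ≡ len q w + iverson (v a <ᵇ v b)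
  swap-back = begin
    len q (v ∘ transp a (suc b)) + iverson (v b <ᵇ v a)
      ≡⟨ cong (_+ iverson (v b <ᵇ v a)) (len-cong q λ y _ _ → w∘s≗v∘transp y) ⟨
    len q (w ∘ s b) + iverson (v b <ᵇ v a)
      ≡⟨ cong₂ (λ x y → len q (w ∘ s b) + iverson (y <ᵇ x)) wb≡va w[1+b]≡vb ⟨
    len q (w ∘ s b) + iverson (w (suc b) <ᵇ w b)
      ≡⟨ len-∘s w m (≤⇒≤′ 1+b≤q) ⟩
    len q w + iverson (w b <ᵇ w (suc b))
      ≡⟨ cong₂ (λ x y → len q w + iverson (x <ᵇ y)) wb≡va w[1+b]≡vb ⟩
    len q w + iverson (v a <ᵇ v b)
      ∎
    where open ≡-Reasoning

BruhatLe-respˡ : ∀ {q v v′ w} → v ≗ v′ → BruhatLe q v w → BruhatLe q v′ w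
BruhatLe-respˡ v≗v′ (done v≈w) = done λ x 1≤x x≤q → trans (sym (v≗v′ x)) (v≈w x 1≤x x≤q)
BruhatLe-respˡ {q} v≗v′ (step a b 1≤a a<b b≤q ℓv≤ℓvt v∘t≤w) =
  step a b 1≤a a<b b≤q
    (subst₂ _≤_ (len-cong q λ x _ _ → v≗v′ x) (len-cong q λ x _ _ → v≗v′ (transp a b x)) ℓv≤ℓvt)
    (BruhatLe-respˡ (v≗v′ ∘ transp a b) v∘t≤w)

BruhatLe-transp : ∀ {q v w a b} → 1 ≤ a → a < b → b ≤ q → w b < w a → (v ∘ transp a b) ≈[ q ] w → BruhatLe q v w
BruhatLe-transp {q} {v} {w} {a} {b} 1≤a a<b b≤q wb<wa v∘t≈w =
  step a b 1≤a a<b b≤q (len≤len-∘transp q v 1≤a a<b b≤q va<vb) (done v∘t≈w)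
  where
  1≤b = ≤-trans 1≤a (<⇒≤ a<b)
  a≤q = ≤-trans (<⇒≤ a<b) b≤q
  va<vb : v a < v b
  va<vb = subst₂ _<_
    (trans (sym (v∘t≈w b 1≤b b≤q)) (cong v (transp-b (<⇒≢ a<b))))
    (trans (sym (v∘t≈w a 1≤a a≤q)) (cong v (transp-a a b)))
    wb<wa

w0J-middle : ∀ q {y} → 3 ≤ y → y ≤ q → w0J q y ≡ (q + 3) ∸ y
w0J-middle q {suc (suc (suc y))} (s≤s (s≤s (s≤s z≤n))) y≤q rewrite ≤⇒≤ᵇ-true y≤q = refl

w0J-high : ∀ q {y} → 3 ≤ y → q < y → w0J q y ≡ y
w0J-high q {suc (suc (suc y))} (s≤s (s≤s (s≤s z≤n))) q<y rewrite >⇒≤ᵇ-false q<y = refl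

w0J-involutive : ∀ q y → w0J q (w0J q y) ≡ y
w0J-involutive q zero                = refl
w0J-involutive q (suc zero)          = refl
w0J-involutive q (suc (suc zero))    = refl
w0J-involutive q y@(suc (suc (suc _))) with y ≤? q
... | yes y≤q = begin
  w0J q (w0J q y)        ≡⟨ cong (w0J q) (w0J-middle q 3≤y y≤q) ⟩
  w0J q ((q + 3) ∸ y)    ≡⟨ w0J-middle q 3≤q+3∸y q+3∸y≤q ⟩
  (q + 3) ∸ ((q + 3) ∸ y) ≡⟨ m∸[m∸n]≡n (≤-trans y≤q (m≤m+n q 3)) ⟩
  y                      ∎
  where
  open ≡-Reasoning
  3≤y : 3 ≤ y
  3≤y = s≤s (s≤s (s≤s z≤n))
  3≤q+3∸y : 3 ≤ (q + 3) ∸ y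
  3≤q+3∸y = subst (_≤ (q + 3) ∸ y) (m+n∸m≡n q 3) (∸-monoʳ-≤ (q + 3) y≤q)
  q+3∸y≤q : (q + 3) ∸ y ≤ q
  q+3∸y≤q = subst ((q + 3) ∸ y ≤_) (m+n∸n≡m q 3) (∸-monoʳ-≤ (q + 3) 3≤y)
... | no y≰q = trans (cong (w0J q) y↦y) y↦y
  where
  y↦y : w0J q y ≡ y
  y↦y = w0J-high q (s≤s (s≤s (s≤s z≤n))) (≰⇒> y≰q)

w0J-conj-s : ∀ {q k j} → 3 ≤ k → k < q → k + j ≡ q + 2 → ∀ y → w0J q (s k (w0J q y)) ≡ s j y
w0J-conj-s {q} {k} {j} 3≤k k<q k+j≡q+2 y = begin
  w0J q (s k (w0J q y))                     ≡⟨ conj-transp (w0J q) (w0J-involutive q) k (suc k) y ⟩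
  transp (w0J q k) (w0J q (suc k)) y        ≡⟨ cong₂ (λ a b → transp a b y) w0k≡1+j w0[1+k]≡j ⟩
  transp (suc j) j y                        ≡⟨ transp-comm (>⇒≢ (n<1+n j)) y ⟩
  s j y                                     ∎
  where
  open ≡-Reasoning
  q+3≡k+1+j : q + 3 ≡ k + suc j
  q+3≡k+1+j = trans (+-suc q 2) (trans (cong suc (sym k+j≡q+2)) (sym (+-suc k j)))
  w0k≡1+j : w0J q k ≡ suc j
  w0k≡1+j = trans (w0J-middle q 3≤k (<⇒≤ k<q)) (trans (cong (_∸ k) q+3≡k+1+j) (m+n∸m≡n k (suc j)))
  w0[1+k]≡j : w0J q (suc k) ≡ j
  w0[1+k]≡j = trans (w0J-middle q (m≤n⇒m≤1+n 3≤k) k<q)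
                    (trans (cong (_∸ suc k) (trans q+3≡k+1+j (+-suc k j))) (m+n∸m≡n (suc k) j))

ClosureLe-from-s : ∀ {q k j w w′} → InJ q k → 3 ≤ k → k + j ≡ q + 2 → BruhatLe q (s k ∘ w ∘ s j) w′ → ClosureLe q w w′
ClosureLe-from-s {k = k} {w = w} k∈J@(_ , k<q , _) 3≤k k+j≡q+2 le =
  k ∷ [] , k∈J ∷ [] , BruhatLe-respˡ (λ y → cong (s k ∘ w) (sym (w0J-conj-s 3≤k k<q k+j≡q+2 y))) le

cyc-before : ∀ i {u y} → i ≤ u → y < i → cyc i u y ≡ y
cyc-before _ i≤u y<i rewrite >⇒≤ᵇ-false y<i | ≢⇒≡ᵇ-false (<⇒≢ (<-≤-trans y<i i≤u)) = refl

cyc-inside : ∀ i {u y} → i ≤ y → y < u → cyc i u y ≡ suc y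
cyc-inside _ i≤y y<u rewrite ≤⇒≤ᵇ-true i≤y | <⇒<ᵇ-true y<u = refl

cyc-end : ∀ i u → cyc i u u ≡ i
cyc-end i u rewrite ≥⇒<ᵇ-false (≤-refl {u}) | ∧-zeroʳ (i ≤ᵇ u) | ≡ᵇ-refl u = refl

cyc-after : ∀ i {u y} → u < y → cyc i u y ≡ y
cyc-after i {u} {y} u<y rewrite ≥⇒<ᵇ-false (<⇒≤ u<y) | ∧-zeroʳ (i ≤ᵇ y) | ≢⇒≡ᵇ-false (>⇒≢ u<y) = refl

data Position (i u y : ℕ) : Set where
  before : y < i → Position i u y
  inside : i ≤ y → y < u → Position i u y
  at-end : y ≡ u → Position i u y
  after  : u < y → Position i u y

position : ∀ i u y → Position i u y
position i u y with y <? i | <-cmp y u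
... | yes y<i | _            = before y<i
... | no y≮i  | tri< y<u _ _ = inside (≮⇒≥ y≮i) y<u
... | no _    | tri≈ _ y≡u _ = at-end y≡u
... | no _    | tri> _ _ u<y = after u<y

cyc-fixes-or-≤ : ∀ {i u} y → i ≤ u → cyc i u y ≡ y ⊎ cyc i u y ≤ u
cyc-fixes-or-≤ {i} {u} y i≤u with position i u y
... | before y<i     = inj₁ (cyc-before i i≤u y<i)
... | inside i≤y y<u = inj₂ (subst (_≤ u) (sym (cyc-inside i i≤y y<u)) y<u)
... | at-end refl    = inj₂ (subst (_≤ u) (sym (cyc-end i u)) i≤u)
... | after u<y      = inj₁ (cyc-after i u<y)

cyc-suc∘s : ∀ i {n} → i ≤ n → ∀ z → cyc i (suc n) (s n z) ≡ cyc i n z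
cyc-suc∘s i {n} i≤n z with z ≟ n | z ≟ suc n
... | yes refl | _ = begin
  cyc i (suc z) (s z z)  ≡⟨ cong (cyc i (suc z)) (s-a z) ⟩
  cyc i (suc z) (suc z)  ≡⟨ cyc-end i (suc z) ⟩
  i                      ≡⟨ cyc-end i z ⟨
  cyc i z z              ∎
  where open ≡-Reasoning
... | no _ | yes refl = begin
  cyc i (suc n) (s n (suc n))  ≡⟨ cong (cyc i (suc n)) (s-b n) ⟩
  cyc i (suc n) n              ≡⟨ cyc-inside i i≤n (n<1+n n) ⟩
  suc n                        ≡⟨ cyc-after i (n<1+n n) ⟨
  cyc i n (suc n)              ∎
  where open ≡-Reasoning
... | no z≢n | no z≢1+n = trans (cong (cyc i (suc n)) (transp-other z≢n z≢1+n)) agree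
  where
  agree : cyc i (suc n) z ≡ cyc i n z
  agree with position i n z
  ... | before z<i     = trans (cyc-before i (m≤n⇒m≤1+n i≤n) z<i) (sym (cyc-before i i≤n z<i))
  ... | inside i≤z z<n = trans (cyc-inside i i≤z (m<n⇒m<1+n z<n)) (sym (cyc-inside i i≤z z<n))
  ... | at-end z≡n     = contradiction z≡n z≢n
  ... | after n<z      = trans (cyc-after i (≤∧≢⇒< n<z (z≢1+n ∘ sym))) (sym (cyc-after i n<z))

cyc∘transp-comm : ∀ i {u a b} → i ≤ u → u < a → a < b → ∀ y → cyc i u (transp a b y) ≡ transp a b (cyc i u y)
cyc∘transp-comm i {u} {a} {b} i≤u u<a a<b y with y ≟ a | y ≟ b
... | yes refl | _ = begin
  cyc i u (transp y b y)  ≡⟨ cong (cyc i u) (transp-a y b) ⟩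
  cyc i u b               ≡⟨ cyc-after i (<-trans u<a a<b) ⟩
  b                       ≡⟨ transp-a y b ⟨
  transp y b y            ≡⟨ cong (transp y b) (cyc-after i u<a) ⟨
  transp y b (cyc i u y)  ∎
  where open ≡-Reasoning
... | no _ | yes refl = begin
  cyc i u (transp a y y)  ≡⟨ cong (cyc i u) (transp-b (<⇒≢ a<b)) ⟩
  cyc i u a               ≡⟨ cyc-after i u<a ⟩
  a                       ≡⟨ transp-b (<⇒≢ a<b) ⟨
  transp a y y            ≡⟨ cong (transp a y) (cyc-after i (<-trans u<a a<b)) ⟨
  transp a y (cyc i u y)  ∎
  where open ≡-Reasoning
... | no y≢a | no y≢b =
  trans (cong (cyc i u) (transp-other y≢a y≢b)) (sym (transp-other (avoids y≢a u<a) (avoids y≢b (<-trans u<a a<b))))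
  where
  avoids : ∀ {c} → y ≢ c → u < c → cyc i u y ≢ c
  avoids {c} y≢c u<c with cyc-fixes-or-≤ y i≤u
  ... | inj₁ fixes = subst (_≢ c) (sym fixes) y≢c
  ... | inj₂ ≤u    = <⇒≢ (≤-<-trans ≤u u<c)

s∘cyc∘transp : ∀ i {n} → i ≤ n → ∀ z → s (suc n) (cyc i n (transp n (2 + n) z)) ≡ cyc i (2 + n) z
s∘cyc∘transp i {n} i≤n z with z ≟ n | z ≟ suc n | z ≟ 2 + n
... | yes refl | _ | _ = begin
  s (suc z) (cyc i z (transp z (2 + z) z))  ≡⟨ cong (s (suc z) ∘ cyc i z) (transp-a z (2 + z)) ⟩
  s (suc z) (cyc i z (2 + z))               ≡⟨ cong (s (suc z)) (cyc-after i (m<n⇒m<1+n (n<1+n z))) ⟩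
  s (suc z) (2 + z)                         ≡⟨ s-b (suc z) ⟩
  suc z                                     ≡⟨ cyc-inside i i≤n (m<n⇒m<1+n (n<1+n z)) ⟨
  cyc i (2 + z) z                           ∎
  where open ≡-Reasoning
... | no z≢n | yes refl | _ = begin
  s (suc n) (cyc i n (transp n (2 + n) (suc n)))  ≡⟨ cong (s (suc n) ∘ cyc i n) (transp-other z≢n (<⇒≢ (n<1+n (suc n)))) ⟩
  s (suc n) (cyc i n (suc n))                     ≡⟨ cong (s (suc n)) (cyc-after i (n<1+n n)) ⟩
  s (suc n) (suc n)                               ≡⟨ s-a (suc n) ⟩
  2 + n                                           ≡⟨ cyc-inside i (m≤n⇒m≤1+n i≤n) (n<1+n (suc n)) ⟨
  cyc i (2 + n) (suc n)                           ∎
  where open ≡-Reasoning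
... | no _ | no _ | yes refl = begin
  s (suc n) (cyc i n (transp n (2 + n) (2 + n)))  ≡⟨ cong (s (suc n) ∘ cyc i n) (transp-b (<⇒≢ (m<n⇒m<1+n (n<1+n n)))) ⟩
  s (suc n) (cyc i n n)                           ≡⟨ cong (s (suc n)) (cyc-end i n) ⟩
  s (suc n) i                                     ≡⟨ s-below (s≤s i≤n) ⟩
  i                                               ≡⟨ cyc-end i (2 + n) ⟨
  cyc i (2 + n) (2 + n)                           ∎
  where open ≡-Reasoning
... | no z≢n | no z≢1+n | no z≢2+n = trans (cong (s (suc n) ∘ cyc i n) (transp-other z≢n z≢2+n)) agree
  where
  agree : s (suc n) (cyc i n z) ≡ cyc i (2 + n) z
  agree with position i n z
  ... | before z<i = begin
    s (suc n) (cyc i n z)  ≡⟨ cong (s (suc n)) (cyc-before i i≤n z<i) ⟩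
    s (suc n) z            ≡⟨ s-below (m<n⇒m<1+n (<-≤-trans z<i i≤n)) ⟩
    z                      ≡⟨ cyc-before i (m≤n⇒m≤1+n (m≤n⇒m≤1+n i≤n)) z<i ⟨
    cyc i (2 + n) z        ∎
    where open ≡-Reasoning
  ... | inside i≤z z<n = begin
    s (suc n) (cyc i n z)  ≡⟨ cong (s (suc n)) (cyc-inside i i≤z z<n) ⟩
    s (suc n) (suc z)      ≡⟨ s-below (s≤s z<n) ⟩
    suc z                  ≡⟨ cyc-inside i i≤z (m<n⇒m<1+n (m<n⇒m<1+n z<n)) ⟨
    cyc i (2 + n) z        ∎
    where open ≡-Reasoning
  ... | at-end z≡n = contradiction z≡n z≢n
  ... | after n<z = begin
    s (suc n) (cyc i n z)  ≡⟨ cong (s (suc n)) (cyc-after i n<z) ⟩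
    s (suc n) z            ≡⟨ s-above 2+n<z ⟩
    z                      ≡⟨ cyc-after i 2+n<z ⟨
    cyc i (2 + n) z        ∎
    where
    open ≡-Reasoning
    2+n<z : 2 + n < z
    2+n<z = ≤∧≢⇒< (≤∧≢⇒< n<z (z≢1+n ∘ sym)) (z≢2+n ∘ sym)

s-suc∘cyc : ∀ i {n u} → i ≤ n → suc n < u → ∀ z → s (suc n) (cyc i u z) ≡ cyc i u (s n z)
s-suc∘cyc i {n} {u} i≤n 1+n<u z with z ≟ n | z ≟ suc n
... | yes refl | _ = begin
  s (suc z) (cyc i u z)  ≡⟨ cong (s (suc z)) (cyc-inside i i≤n (<-trans (n<1+n z) 1+n<u)) ⟩
  s (suc z) (suc z)      ≡⟨ s-a (suc z) ⟩
  2 + z                  ≡⟨ cyc-inside i (m≤n⇒m≤1+n i≤n) 1+n<u ⟨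
  cyc i u (suc z)        ≡⟨ cong (cyc i u) (s-a z) ⟨
  cyc i u (s z z)        ∎
  where open ≡-Reasoning
... | no _ | yes refl = begin
  s (suc n) (cyc i u (suc n))  ≡⟨ cong (s (suc n)) (cyc-inside i (m≤n⇒m≤1+n i≤n) 1+n<u) ⟩
  s (suc n) (2 + n)            ≡⟨ s-b (suc n) ⟩
  suc n                        ≡⟨ cyc-inside i i≤n (<-trans (n<1+n n) 1+n<u) ⟨
  cyc i u n                    ≡⟨ cong (cyc i u) (s-b n) ⟨
  cyc i u (s n (suc n))        ∎
  where open ≡-Reasoning
... | no z≢n | no z≢1+n = trans fixes (sym (cong (cyc i u) (transp-other z≢n z≢1+n)))
  where
  fixes : s (suc n) (cyc i u z) ≡ cyc i u z
  i≤u = <⇒≤ (≤-<-trans i≤n (<-trans (n<1+n n) 1+n<u))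
  fixes with position i u z
  ... | before z<i     = trans (cong (s (suc n)) (cyc-before i i≤u z<i))
                               (trans (s-below (m<n⇒m<1+n (<-≤-trans z<i i≤n))) (sym (cyc-before i i≤u z<i)))
  ... | inside i≤z z<u = trans (cong (s (suc n)) (cyc-inside i i≤z z<u))
                               (trans (transp-other (z≢n ∘ suc-injective) (z≢1+n ∘ suc-injective)) (sym (cyc-inside i i≤z z<u)))
  ... | at-end refl    = trans (cong (s (suc n)) (cyc-end i z)) (trans (s-below (s≤s i≤n)) (sym (cyc-end i z)))
  ... | after u<z      = trans (cong (s (suc n)) (cyc-after i u<z)) (trans (s-above (≤-<-trans 1+n<u u<z)) (sym (cyc-after i u<z)))

γ[1+j,m]⪯γ[j,2+m] : ∀ {q j m} → 3 ≤ j → j < m → j + m ≡ q + 1 → ClosureLe q (γ (j + 1) m) (γ j (2 + m))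
γ[1+j,m]⪯γ[j,2+m] {q} {j} {m} 3≤j j<m j+m≡q+1 =
  ClosureLe-from-s {w = γ (j + 1) m} {w′ = γ j (2 + m)} (s≤s z≤n , 2+m≤q , 1+m≢2) (s≤s 2≤m) 1+m+j≡q+2
    (BruhatLe-transp (≤-trans (s≤s z≤n) 2≤m) m<2+m 2+m≤q γ′[2+m]<γ′[m] λ y _ _ → twist y)
  where
  1≤j = ≤-trans (s≤s z≤n) 3≤j
  m<2+m = m<n⇒m<1+n (n<1+n m)
  2≤m = ≤-trans (s≤s (s≤s z≤n)) (≤-trans 3≤j (<⇒≤ j<m))
  1+m≢2 : suc m ≢ 2
  1+m≢2 refl = <⇒≱ (s≤s (s≤s z≤n)) 2≤m
  2+m≤q : 2 + m ≤ q
  2+m≤q = ≤-pred (subst (3 + m ≤_) (trans j+m≡q+1 (+-comm q 1)) (+-monoˡ-≤ m 3≤j))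
  1+m+j≡q+2 : suc m + j ≡ q + 2
  1+m+j≡q+2 = trans (cong suc (trans (+-comm m j) j+m≡q+1)) (sym (+-suc q 1))
  γ′[2+m]<γ′[m] : γ j (2 + m) (2 + m) < γ j (2 + m) m
  γ′[2+m]<γ′[m] = subst₂ _<_
    (sym (trans (cong (cyc 2 (2 + m)) (cyc-after 1 (<-trans j<m m<2+m))) (cyc-end 2 (2 + m))))
    (sym (trans (cong (cyc 2 (2 + m)) (cyc-after 1 j<m)) (cyc-inside 2 2≤m m<2+m)))
    (s≤s 2≤m)
  twist : ∀ y → s (suc m) (γ (j + 1) m (s j (transp m (2 + m) y))) ≡ γ j (2 + m) y
  twist y = begin
    s (suc m) (cyc 2 m (cyc 1 (j + 1) (s j (t y))))  ≡⟨ cong (λ u → s (suc m) (cyc 2 m (cyc 1 u (s j (t y))))) (+-comm j 1) ⟩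
    s (suc m) (cyc 2 m (cyc 1 (suc j) (s j (t y))))  ≡⟨ cong (s (suc m) ∘ cyc 2 m) (cyc-suc∘s 1 1≤j (t y)) ⟩
    s (suc m) (cyc 2 m (cyc 1 j (t y)))              ≡⟨ cong (s (suc m) ∘ cyc 2 m) (cyc∘transp-comm 1 1≤j j<m m<2+m y) ⟩
    s (suc m) (cyc 2 m (t (cyc 1 j y)))              ≡⟨ s∘cyc∘transp 2 2≤m (cyc 1 j y) ⟩
    cyc 2 (2 + m) (cyc 1 j y)                        ∎
    where
    open ≡-Reasoning
    t = transp m (2 + m)

γ[n,1+j]⪯γ[2+n,j] : ∀ {q j n} → 1 ≤ n → 2 + n < j → n + j ≡ q → ClosureLe q (γ n (j + 1)) (γ (2 + n) j)
γ[n,1+j]⪯γ[2+n,j] {q} {j} {n} 1≤n 2+n<j n+j≡q =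
  ClosureLe-from-s {w = γ n (j + 1)} {w′ = γ (2 + n) j} (s≤s z≤n , 2+n<q , 2+n≢2) (s≤s (s≤s 1≤n)) 2+n+j≡q+2
    (BruhatLe-transp 1≤n n<2+n (<⇒≤ 2+n<q) γ′[2+n]<γ′[n] λ y _ _ → twist y)
  where
  2≤j = ≤-trans (s≤s (s≤s z≤n)) (<⇒≤ 2+n<j)
  n<2+n = m<n⇒m<1+n (n<1+n n)
  n<j = <-trans n<2+n 2+n<j
  2+n≢2 : 2 + n ≢ 2
  2+n≢2 refl = <⇒≱ 1≤n z≤n
  2+n<q : 2 + n < q
  2+n<q = subst (2 + n <_) n+j≡q (≤-trans 2+n<j (m≤n+m j n))
  2+n+j≡q+2 : 2 + n + j ≡ q + 2
  2+n+j≡q+2 = trans (cong (2 +_) n+j≡q) (+-comm 2 q)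
  γ′[2+n]<γ′[n] : γ (2 + n) j (2 + n) < γ (2 + n) j n
  γ′[2+n]<γ′[n] = subst₂ _<_
    (sym (trans (cong (cyc 2 j) (cyc-end 1 (2 + n))) (cyc-before 2 2≤j (s≤s (s≤s z≤n)))))
    (sym (trans (cong (cyc 2 j) (cyc-inside 1 1≤n n<2+n)) (cyc-inside 2 (s≤s 1≤n) (<-trans (n<1+n (suc n)) 2+n<j))))
    (s≤s (s≤s z≤n))
  twist : ∀ y → s (2 + n) (γ n (j + 1) (s j (transp n (2 + n) y))) ≡ γ (2 + n) j y
  twist y = begin
    s (2 + n) (cyc 2 (j + 1) (cyc 1 n (s j (t y))))  ≡⟨ cong (s (2 + n) ∘ cyc 2 (j + 1)) (cyc∘transp-comm 1 1≤n n<j (n<1+n j) (t y)) ⟩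
    s (2 + n) (cyc 2 (j + 1) (s j (cyc 1 n (t y))))  ≡⟨ cong (λ u → s (2 + n) (cyc 2 u (s j (cyc 1 n (t y))))) (+-comm j 1) ⟩
    s (2 + n) (cyc 2 (suc j) (s j (cyc 1 n (t y))))  ≡⟨ cong (s (2 + n)) (cyc-suc∘s 2 2≤j (cyc 1 n (t y))) ⟩
    s (2 + n) (cyc 2 j (cyc 1 n (t y)))              ≡⟨ s-suc∘cyc 2 (s≤s 1≤n) 2+n<j (cyc 1 n (t y)) ⟩
    cyc 2 j (s (suc n) (cyc 1 n (t y)))              ≡⟨ cong (cyc 2 j) (s∘cyc∘transp 1 1≤n y) ⟩
    cyc 2 j (cyc 1 (2 + n) y)                        ∎
    where
    open ≡-Reasoning
    t = transp n (2 + n)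

theorem3p11 : (q : ℕ) → 5 ≤ q →
    ((j : ℕ) → 3 ≤ j → 2 * j < q →
      ClosureLe q (γ (j + 1) ((q + 1) ∸ j)) (γ j ((q + 3) ∸ j)))
    × ((j : ℕ) → q + 2 < 2 * j → j ≤ q ∸ 1 →
      ClosureLe q (γ (q ∸ j) (j + 1)) (γ ((q ∸ j) + 2) j))
theorem3p11 q 5≤q = part₁ , part₂
  where
  part₁ : (j : ℕ) → 3 ≤ j → 2 * j < q → ClosureLe q (γ (j + 1) ((q + 1) ∸ j)) (γ j ((q + 3) ∸ j))
  part₁ j 3≤j 2j<q = subst (ClosureLe q (γ (j + 1) m) ∘ γ j) 2+m≡q+3∸j (γ[1+j,m]⪯γ[j,2+m] 3≤j j<m (m+[n∸m]≡n j≤q+1))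
    where
    m = (q + 1) ∸ j
    1+j+j≤q+1 : suc j + j ≤ q + 1
    1+j+j≤q+1 = ≤-trans (subst (_< q) (cong (j +_) (+-identityʳ j)) 2j<q) (m≤m+n q 1)
    j≤q+1 : j ≤ q + 1
    j≤q+1 = ≤-trans (m≤m+n j (suc j)) (subst (_≤ q + 1) (+-comm (suc j) j) 1+j+j≤q+1)
    j<m : j < m
    j<m = m+n≤o⇒m≤o∸n (suc j) 1+j+j≤q+1
    2+m≡q+3∸j : 2 + m ≡ (q + 3) ∸ j
    2+m≡q+3∸j = sym (trans (cong (_∸ j) (sym (+-assoc q 1 2))) (trans (+-∸-comm 2 j≤q+1) (+-comm m 2)))
  part₂ : (j : ℕ) → q + 2 < 2 * j → j ≤ q ∸ 1 → ClosureLe q (γ (q ∸ j) (j + 1)) (γ ((q ∸ j) + 2) j)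
  part₂ j q+2<2j j≤q∸1 = subst (ClosureLe q (γ n (j + 1)) ∘ (λ k → γ k j)) (+-comm 2 n) (γ[n,1+j]⪯γ[2+n,j] 1≤n 2+n<j n+j≡q)
    where
    n = q ∸ j
    j<q : j < q
    j<q = subst (j <_) (m+[n∸m]≡n (≤-trans (s≤s z≤n) 5≤q)) (s≤s j≤q∸1)
    n+j≡q : n + j ≡ q
    n+j≡q = m∸n+n≡m (<⇒≤ j<q)
    1≤n : 1 ≤ n
    1≤n = m<n⇒0<n∸m j<q
    2+n<j : 2 + n < j
    2+n<j = +-cancelʳ-< j (2 + n) j (subst₂ _<_ (trans (+-comm q 2) (cong (2 +_) (sym n+j≡q))) (cong (j +_) (+-identityʳ j)) q+2<2j)
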